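{- Let $k \ge 4$ and let $G$ be a connected graph that is $(P_k,C_k)$-free. Let $X$ be a minimal connected dominating set of $G$. Then the induced subgraph $G[X]$ is $P_{k-2}$-free.
   Context: All graphs are finite and simple. A dominating set of $G$ is a vertex subset $X$ such that every vertex not in $X$ has a neighbor in $X$. A connected dominating set is a dominating set $X$ with $G[X]$ connected. A minimal connected dominating set is a connected dominating set no proper subset of which is a connected dominating set. $P_k$ denotes the path on $k$ vertices and $C_k$ the cycle on $k$ vertices; $G$ is $(P_k,C_k)$-free if it contains neither $P_k$ nor $C_k$ as an induced subgraph, and $P_{k-2}$-free means containing no induced $P_{k-2}$. -}

module Defs where

open import Data.Nat using (ℕ; zero; suc; _≤_; _∸_)
open import Data.Fin using (Fin; toℕ)
open import Data.Fin.Subset using (Subset; _∈_; _∉_; _⊂_; ⊤)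
open import Data.Product using (∃; _×_; _,_)
open import Data.Sum using (_⊎_)
open import Relation.Nullary using (¬_)
open import Relation.Binary.PropositionalEquality using (_≡_)
open import Function.Definitions using (Injective)
open import Function.Bundles using (_⇔_)

record Graph (n : ℕ) : Set₁ where
  field
    Adj     : Fin n → Fin n → Set
    irrefl  : ∀ {u} → ¬ Adj u u
    sym     : ∀ {u v} → Adj u v → Adj v u

open Graph public

full : ∀ {n} → Subset n
full = ⊤

PathAdj : ∀ {k} → Fin k → Fin k → Set
PathAdj i j = (suc (toℕ i) ≡ toℕ j) ⊎ (suc (toℕ j) ≡ toℕ i)

CycAdj : ∀ {k} → Fin k → Fin k → Set
CycAdj {k} i j = PathAdj i j
               ⊎ ((toℕ i ≡ 0 × suc (toℕ j) ≡ k) ⊎ (toℕ j ≡ 0 × suc (toℕ i) ≡ k))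

module _ {n : ℕ} (G : Graph n) where

  data WalkIn (X : Subset n) : Fin n → Fin n → Set where
    here : ∀ {u} → u ∈ X → WalkIn X u u
    step : ∀ {u w v} → u ∈ X → Adj G u w → WalkIn X w v → WalkIn X u v

  ConnectedIn : Subset n → Set
  ConnectedIn X = ∀ {u v} → u ∈ X → v ∈ X → WalkIn X u v

  Connected : Set
  Connected = ConnectedIn full

  Dominating : Subset n → Set
  Dominating X = ∀ v → v ∉ X → ∃ λ u → u ∈ X × Adj G u v

  ConnectedDominating : Subset n → Set
  ConnectedDominating X = Dominating X × ConnectedIn X

  MinimalConnectedDominating : Subset n → Set
  MinimalConnectedDominating X =
    ConnectedDominating X × (∀ Y → Y ⊂ X → ¬ ConnectedDominating Y)

  HasInducedPathIn : Subset n → ℕ → Set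
  HasInducedPathIn X m =
    ∃ λ (p : Fin m → Fin n) →
      Injective _≡_ _≡_ p × (∀ i → p i ∈ X) × (∀ i j → Adj G (p i) (p j) ⇔ PathAdj i j)

  HasInducedCycleIn : Subset n → ℕ → Set
  HasInducedCycleIn X m =
    3 ≤ m × ∃ λ (p : Fin m → Fin n) →
      Injective _≡_ _≡_ p × (∀ i → p i ∈ X) × (∀ i j → Adj G (p i) (p j) ⇔ CycAdj i j)

  PathFree : ℕ → Set
  PathFree m = ¬ HasInducedPathIn full m

  CycleFree : ℕ → Set
  CycleFree m = ¬ HasInducedCycleIn full m

  PathFreeIn : Subset n → ℕ → Set
  PathFreeIn X m = ¬ HasInducedPathIn X m

-- Let p₀ … p_{m−1} (m = k − 2 ≥ 2) be an induced path in G[X]. Minimality of X forces each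
-- endpoint, say p₀, to have a private neighbour y: adjacent to p₀, to no other pᵢ, and off the
-- path. Otherwise X − p₀ is still a connected dominating set: a vertex dominated only by p₀
-- would be such a y, and a vertex of X − p₀ adjacent to p₀ that is not such a y reaches p₁
-- through the path, so connectivity of G[X] survives. The private neighbours y₁ of p₀ and
-- y₂ of p_{m−1} are distinct, so y₁ p₀ … p_{m−1} y₂ is an induced P_k, or an induced C_k if
-- y₁y₂ is an edge. The goal is a negation, so the case distinctions may be made classically
-- under a double negation.
module Submission where

open import Defs
open import Data.Nat using (ℕ; zero; suc; _≤_; _<_; _∸_; z≤n; s≤s)
open import Data.Nat.Properties using (suc-injective; +-∸-assoc; <-irrefl; <-asym; n<1+n; 1+n≢n)
open import Data.Fin using (Fin; zero; suc; toℕ; fromℕ; inject₁; opposite; _≟_)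
open import Data.Fin.Properties
  using (toℕ-injective; toℕ-inject₁; toℕ-fromℕ; toℕ<n; opposite-prop; opposite-involutive)
open import Data.Fin.Subset using (Subset; _∈_; _∉_; _⊂_; _─_; _-_; ⁅_⁆; inside; outside)
open import Data.Fin.Subset.Properties
  using (∈⊤; x∈p∧x∉q⇒x∈p─q; p─q⊆p; p∩q≢∅⇒p─q⊂p; x∈p∩q⁺; x∈⁅x⁆; x≢y⇒x∉⁅y⁆)
open import Data.Vec.Base using (_∷_; here; there)
open import Data.Product using (∃; _×_; _,_; proj₁; proj₂; map₁)
open import Data.Sum using (_⊎_; inj₁; inj₂; [_,_]; map; swap)
open import Data.Empty using (⊥-elim)
open import Function using (_∘_; id)
open import Function.Definitions using (Injective)
open import Function.Bundles using (_⇔_; mk⇔; module Equivalence)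
open import Relation.Nullary using (¬_; yes; no)
open import Relation.Nullary.Decidable using (¬¬-excluded-middle)
open import Relation.Nullary.Negation using (¬¬-map)
open import Relation.Binary.PropositionalEquality
  using (_≡_; _≢_; refl; trans; cong; subst; subst₂; module ≡-Reasoning)
  renaming (sym to ≡-sym)

open Equivalence using (to; from)

¬¬-shift : ∀ {m} {P : Fin m → Set} → (∀ i → ¬ ¬ P i) → ¬ ¬ (∀ i → P i)
¬¬-shift {zero}  _   k = k λ ()
¬¬-shift {suc m} ¬¬P k =
  ¬¬P zero λ P₀ → ¬¬-shift (¬¬P ∘ suc) λ Pₛ → k λ { zero → P₀ ; (suc i) → Pₛ i }

¬¬-premise : ∀ {A B : Set} → (A → ¬ ¬ B) → ¬ ¬ (A → B)
¬¬-premise f k = k λ a → ⊥-elim (f a λ b → k λ _ → b)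

x∈p─q⇒x∉q : ∀ {n} {p q : Subset n} {x} → x ∈ p ─ q → x ∉ q
x∈p─q⇒x∉q {p = inside ∷ _} {outside ∷ _} here      ()
x∈p─q⇒x∉q {p = _ ∷ _}      {_ ∷ _}       (there h) (there h′) = x∈p─q⇒x∉q h h′

x∉p-x : ∀ {n} {p : Subset n} {x} → x ∉ p - x
x∉p-x {x = x} h = x∈p─q⇒x∉q h (x∈⁅x⁆ x)

x∈p⇒p-x⊂p : ∀ {n} {p : Subset n} {x} → x ∈ p → p - x ⊂ p
x∈p⇒p-x⊂p {p = p} {x} x∈p = p∩q≢∅⇒p─q⊂p p ⁅ x ⁆ (x , x∈p∩q⁺ (x∈p , x∈⁅x⁆ x))

x∈p∧x≢y⇒x∈p-y : ∀ {n} {p : Subset n} {x y} → x ∈ p → x ≢ y → x ∈ p - y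
x∈p∧x≢y⇒x∈p-y x∈p x≢y = x∈p∧x∉q⇒x∈p─q x∈p (x≢y⇒x∉⁅y⁆ x≢y)

opposite-step : ∀ {M} (i j : Fin M) → suc (toℕ i) ≡ toℕ j →
  suc (toℕ (opposite j)) ≡ toℕ (opposite i)
opposite-step {M} i j 1+i≡j = begin
  suc (toℕ (opposite j))  ≡⟨ cong suc (opposite-prop j) ⟩
  suc (M ∸ suc (toℕ j))   ≡⟨ +-∸-assoc 1 (toℕ<n j) ⟨
  M ∸ toℕ j               ≡⟨ cong (M ∸_) 1+i≡j ⟨
  M ∸ suc (toℕ i)         ≡⟨ opposite-prop i ⟨
  toℕ (opposite i)        ∎
  where open ≡-Reasoning

PathAdj-opposite : ∀ {M} {i j : Fin M} → PathAdj i j → PathAdj (opposite i) (opposite j)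
PathAdj-opposite {i = i} {j} (inj₁ e) = inj₂ (opposite-step i j e)
PathAdj-opposite {i = i} {j} (inj₂ e) = inj₁ (opposite-step j i e)

PathAdj-opposite⁻ : ∀ {M} {i j : Fin M} → PathAdj (opposite i) (opposite j) → PathAdj i j
PathAdj-opposite⁻ {i = i} {j} =
  subst₂ PathAdj (opposite-involutive i) (opposite-involutive j) ∘ PathAdj-opposite

snoc : ∀ {A : Set} {m} → (Fin m → A) → A → Fin (suc m) → A
snoc {m = zero}  q a zero    = a
snoc {m = suc m} q a zero    = q zero
snoc {m = suc m} q a (suc i) = snoc (q ∘ suc) a i

snoc-view : ∀ {A : Set} {m} (q : Fin m → A) (a : A) (i : Fin (suc m)) →
  (∃ λ j → snoc q a i ≡ q j × toℕ i ≡ toℕ j) ⊎ (snoc q a i ≡ a × toℕ i ≡ m)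
snoc-view {m = zero}  q a zero    = inj₂ (refl , refl)
snoc-view {m = suc m} q a zero    = inj₁ (zero , refl , refl)
snoc-view {m = suc m} q a (suc i) with snoc-view (q ∘ suc) a i
... | inj₁ (j , e , t) = inj₁ (suc j , e , cong suc t)
... | inj₂ (e , t)     = inj₂ (e , cong suc t)

module _ {n : ℕ} {G : Graph n} {Y : Subset n} where

  walk-start∈ : ∀ {u v} → WalkIn G Y u v → u ∈ Y
  walk-start∈ (WalkIn.here u∈Y)     = u∈Y
  walk-start∈ (WalkIn.step u∈Y _ _) = u∈Y

  walk-end∈ : ∀ {u v} → WalkIn G Y u v → v ∈ Y
  walk-end∈ (WalkIn.here v∈Y)   = v∈Y
  walk-end∈ (WalkIn.step _ _ q) = walk-end∈ q

  _++ʷ_ : ∀ {u v w} → WalkIn G Y u v → WalkIn G Y v w → WalkIn G Y u w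
  WalkIn.here _       ++ʷ r = r
  WalkIn.step u∈Y a q ++ʷ r = WalkIn.step u∈Y a (q ++ʷ r)

  reverseʷ : ∀ {u v} → WalkIn G Y u v → WalkIn G Y v u
  reverseʷ (WalkIn.here u∈Y)     = WalkIn.here u∈Y
  reverseʷ (WalkIn.step u∈Y a q) =
    reverseʷ q ++ʷ WalkIn.step (walk-start∈ q) (sym G a) (WalkIn.here u∈Y)

  walk-along : ∀ {m} (q : Fin (suc m) → Fin n) → (∀ j → q j ∈ Y) →
    (∀ j → Adj G (q (inject₁ j)) (q (suc j))) → ∀ j → WalkIn G Y (q zero) (q j)
  walk-along         q q∈Y q-adj zero    = WalkIn.here (q∈Y zero)
  walk-along {suc m} q q∈Y q-adj (suc j) =
    WalkIn.step (q∈Y zero) (q-adj zero) (walk-along (q ∘ suc) (q∈Y ∘ suc) (q-adj ∘ suc) j)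

  hub⇒connected : ∀ {c} → (∀ {u} → u ∈ Y → WalkIn G Y u c) → ConnectedIn G Y
  hub⇒connected to-c u∈Y v∈Y = to-c u∈Y ++ʷ reverseʷ (to-c v∈Y)

module _ {n : ℕ} (G : Graph n) where

  record InducedPath {m} (p : Fin m → Fin n) : Set where
    constructor inducedPath
    field
      injective : Injective _≡_ _≡_ p
      adjacent⇔ : ∀ i j → Adj G (p i) (p j) ⇔ PathAdj i j

  open InducedPath

  consecutive : ∀ {m} {p : Fin (suc m) → Fin n} → InducedPath p → ∀ j → Adj G (p (inject₁ j)) (p (suc j))
  consecutive path j = from (adjacent⇔ path (inject₁ j) (suc j)) (inj₁ (cong suc (toℕ-inject₁ j)))

  reverse-path : ∀ {m} {p : Fin m → Fin n} → InducedPath p → InducedPath (p ∘ opposite)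
  reverse-path (inducedPath inj adj) = inducedPath
    (λ e → opposite-injective (inj e))
    (λ i j → mk⇔ (PathAdj-opposite⁻ ∘ to (adj _ _)) (from (adj _ _) ∘ PathAdj-opposite))
    where
    opposite-injective : ∀ {i j} → opposite i ≡ opposite j → i ≡ j
    opposite-injective {i} {j} e =
      trans (≡-sym (opposite-involutive i)) (trans (cong opposite e) (opposite-involutive j))

  record PrivateNeighbour {m} (p : Fin m → Fin n) (i : Fin m) (y : Fin n) : Set where
    field
      adjacent : Adj G (p i) y
      sole     : ∀ j → Adj G (p j) y → j ≡ i
      off-path : ∀ j → y ≢ p j

  ExternalPrivateNeighbour : Subset n → Fin n → Fin n → Set
  ExternalPrivateNeighbour X x v = v ∉ X × Adj G x v × (∀ u → u ∈ X → Adj G u v → u ≡ x)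

  open PrivateNeighbour

  reverse-private : ∀ {m} {p : Fin m → Fin n} {i y} →
    PrivateNeighbour (p ∘ opposite) i y → PrivateNeighbour p (opposite i) y
  reverse-private {p = p} {i} {y} pn = record
    { adjacent = adjacent pn ; sole = sole′ ; off-path = off-path′ }
    where
    p-opposite² : ∀ j → p (opposite (opposite j)) ≡ p j
    p-opposite² j = cong p (opposite-involutive j)

    sole′ : ∀ j → Adj G (p j) y → j ≡ opposite i
    sole′ j a = trans (≡-sym (opposite-involutive j))
      (cong opposite (sole pn (opposite j) (subst (λ v → Adj G v y) (≡-sym (p-opposite² j)) a)))

    off-path′ : ∀ j → y ≢ p j
    off-path′ j e = off-path pn (opposite j) (trans e (≡-sym (p-opposite² j)))

-- Slot u a says that u is the vertex at position a of y₁, p 0, …, p (M − 1), y₂; positions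
-- are natural numbers because PathAdj and CycAdj are stated through toℕ.
module Extension {n m : ℕ} {G : Graph n} {p : Fin (suc (suc m)) → Fin n} (path : InducedPath G p)
  {y₁ y₂ : Fin n} (pn₁ : PrivateNeighbour G p zero y₁) (pn₂ : PrivateNeighbour G p (fromℕ (suc m)) y₂)
  where

  open InducedPath path
  open PrivateNeighbour

  M K : ℕ
  M = suc (suc m)
  K = suc (suc M)

  data Slot : Fin n → ℕ → Set where
    first : Slot y₁ 0
    inner : (j : Fin M) → Slot (p j) (suc (toℕ j))
    final : Slot y₂ (suc M)

  extended : Fin K → Fin n
  extended zero    = y₁
  extended (suc i) = snoc p y₂ i

  slot : ∀ i → Slot (extended i) (toℕ i)
  slot zero = first
  slot (suc i) with snoc-view p y₂ i
  ... | inj₁ (j , e , t) = subst₂ Slot (≡-sym e) (cong suc (≡-sym t)) (inner j)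
  ... | inj₂ (e , t)     = subst₂ Slot (≡-sym e) (cong suc (≡-sym t)) final

  y₁≢y₂ : y₁ ≢ y₂
  y₁≢y₂ e with sole pn₁ (fromℕ (suc m)) (subst (Adj G (p (fromℕ (suc m)))) (≡-sym e) (adjacent pn₂))
  ... | ()

  slot-injective : ∀ {u v a b} → Slot u a → Slot v b → u ≡ v → a ≡ b
  slot-injective first     first     _ = refl
  slot-injective first     (inner j) e = ⊥-elim (off-path pn₁ j e)
  slot-injective first     final     e = ⊥-elim (y₁≢y₂ e)
  slot-injective (inner i) first     e = ⊥-elim (off-path pn₁ i (≡-sym e))
  slot-injective (inner i) (inner j) e = cong (suc ∘ toℕ) (injective e)
  slot-injective (inner i) final     e = ⊥-elim (off-path pn₂ i (≡-sym e))
  slot-injective final     first     e = ⊥-elim (y₁≢y₂ (≡-sym e))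
  slot-injective final     (inner j) e = ⊥-elim (off-path pn₂ j e)
  slot-injective final     final     _ = refl

  extended-injective : Injective _≡_ _≡_ extended
  extended-injective {i} {j} e = toℕ-injective (slot-injective (slot i) (slot j) e)

  PathAdjℕ Ends : ℕ → ℕ → Set
  PathAdjℕ a b = suc a ≡ b ⊎ suc b ≡ a
  Ends     a b = (a ≡ 0 × suc b ≡ K) ⊎ (b ≡ 0 × suc a ≡ K)

  ExtendedAdj : ℕ → ℕ → Set
  ExtendedAdj a b = PathAdjℕ a b ⊎ (Ends a b × Adj G y₁ y₂)

  refute : ∀ {u v a b} → ¬ Adj G u v → ¬ ExtendedAdj a b → Adj G u v ⇔ ExtendedAdj a b
  refute ¬adj ¬ext = mk⇔ (⊥-elim ∘ ¬adj) (⊥-elim ∘ ¬ext)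

  not-ends : ∀ {u v a b} → ¬ Ends a b → Adj G u v ⇔ PathAdjℕ a b → Adj G u v ⇔ ExtendedAdj a b
  not-ends ¬ends adj⇔ = mk⇔ (inj₁ ∘ to adj⇔) [ from adj⇔ , ⊥-elim ∘ ¬ends ∘ proj₁ ]

  adjacency-sym : ∀ {u v a b} → Adj G u v ⇔ ExtendedAdj a b → Adj G v u ⇔ ExtendedAdj b a
  adjacency-sym adj⇔ = mk⇔ (swap′ ∘ to adj⇔ ∘ sym G) (sym G ∘ from adj⇔ ∘ swap′)
    where
    swap′ : ∀ {a b} → ExtendedAdj a b → ExtendedAdj b a
    swap′ = map swap (map₁ swap)

  inner≢K : ∀ (j : Fin M) → suc (suc (toℕ j)) ≢ K
  inner≢K j e = <-irrefl (suc-injective (suc-injective e)) (toℕ<n j)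

  last-index : ∀ (i : Fin M) → suc (toℕ i) ≡ M → i ≡ fromℕ (suc m)
  last-index i e = toℕ-injective (trans (suc-injective e) (≡-sym (toℕ-fromℕ (suc m))))

  slot-adjacent⇔ : ∀ {u v a b} → Slot u a → Slot v b → Adj G u v ⇔ ExtendedAdj a b
  slot-adjacent⇔ first     first     = refute (irrefl G)
    λ { (inj₁ (inj₁ ())) ; (inj₁ (inj₂ ()))
      ; (inj₂ (inj₁ (_ , ()) , _)) ; (inj₂ (inj₂ (_ , ()) , _)) }
  slot-adjacent⇔ first     (inner j) = not-ends (λ { (inj₁ (_ , e)) → inner≢K j e ; (inj₂ (() , _)) })
    (mk⇔ (λ a → inj₁ (cong (suc ∘ toℕ) (≡-sym (sole pn₁ j (sym G a)))))
         λ { (inj₁ e) → subst (Adj G y₁ ∘ p) (toℕ-injective (suc-injective e)) (sym G (adjacent pn₁))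
           ; (inj₂ ()) })
  slot-adjacent⇔ first     final     = mk⇔ (λ a → inj₂ (inj₁ (refl , refl) , a))
    λ { (inj₁ (inj₁ ())) ; (inj₁ (inj₂ ())) ; (inj₂ (_ , a)) → a }
  slot-adjacent⇔ (inner i) (inner j) = not-ends (λ { (inj₁ (() , _)) ; (inj₂ (() , _)) })
    (mk⇔ (map (cong suc) (cong suc) ∘ to (adjacent⇔ i j))
         (from (adjacent⇔ i j) ∘ map suc-injective suc-injective))
  slot-adjacent⇔ (inner i) final     = not-ends (λ { (inj₁ (() , _)) ; (inj₂ (() , _)) })
    (mk⇔ (λ a → inj₁ (cong (λ t → suc (suc t)) (trans (cong toℕ (sole pn₂ i a)) (toℕ-fromℕ (suc m)))))
         λ { (inj₁ e) → subst (λ t → Adj G (p t) y₂)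
                          (≡-sym (last-index i (suc-injective e)))
                          (adjacent pn₂)
           ; (inj₂ e) → ⊥-elim (<-asym (toℕ<n i) (subst (M <_) (suc-injective e) (n<1+n M))) })
  slot-adjacent⇔ (inner i) first     = adjacency-sym (slot-adjacent⇔ first (inner i))
  slot-adjacent⇔ final     first     = adjacency-sym (slot-adjacent⇔ first final)
  slot-adjacent⇔ final     (inner j) = adjacency-sym (slot-adjacent⇔ (inner j) final)
  slot-adjacent⇔ final     final     = refute (irrefl G)
    λ { (inj₁ (inj₁ e)) → 1+n≢n e ; (inj₁ (inj₂ e)) → 1+n≢n e
      ; (inj₂ (inj₁ (() , _) , _)) ; (inj₂ (inj₂ (() , _) , _)) }

  extended-adjacent⇔ : ∀ i j → Adj G (extended i) (extended j) ⇔ ExtendedAdj (toℕ i) (toℕ j)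
  extended-adjacent⇔ i j = slot-adjacent⇔ (slot i) (slot j)

  path-extension : ¬ Adj G y₁ y₂ → HasInducedPathIn G full K
  path-extension ¬y₁y₂ = extended , extended-injective , (λ _ → ∈⊤) , λ i j →
    let adj⇔ = extended-adjacent⇔ i j in
    mk⇔ ([ id , ⊥-elim ∘ ¬y₁y₂ ∘ proj₂ ] ∘ to adj⇔) (from adj⇔ ∘ inj₁)

  cycle-extension : Adj G y₁ y₂ → HasInducedCycleIn G full K
  cycle-extension y₁y₂ = s≤s (s≤s (s≤s z≤n)) , extended , extended-injective , (λ _ → ∈⊤) , λ i j →
    let adj⇔ = extended-adjacent⇔ i j in
    mk⇔ (map id proj₁ ∘ to adj⇔) (from adj⇔ ∘ map id (_, y₁y₂))

module _ {n : ℕ} (G : Graph n) {X : Subset n} {x : Fin n} where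

  removal-dominating : Dominating G X → ∃ (λ c → c ∈ X - x × Adj G c x) →
    (∀ v → ¬ ExternalPrivateNeighbour G X x v) → ¬ ¬ Dominating G (X - x)
  removal-dominating dom (c , c∈X-x , c~x) no-epn = ¬¬-shift dominated
    where
    dominated : ∀ v → ¬ ¬ (v ∉ X - x → ∃ λ u → u ∈ X - x × Adj G u v)
    dominated v k with v ≟ x
    ... | yes refl = k λ _ → c , c∈X-x , c~x
    ... | no v≢x   = ¬¬-excluded-middle λ
      { (yes d)  → k λ _ → d
      ; (no ¬d) → k λ v∉X-x → ⊥-elim (no-epn v (external-private v∉X-x ¬d)) }
      where
      external-private : v ∉ X - x → ¬ (∃ λ u → u ∈ X - x × Adj G u v) → ExternalPrivateNeighbour G X x v
      external-private v∉X-x ¬d = v∉X , x~v , sole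
        where
        v∉X : v ∉ X
        v∉X v∈X = v∉X-x (x∈p∧x≢y⇒x∈p-y v∈X v≢x)

        sole : ∀ u → u ∈ X → Adj G u v → u ≡ x
        sole u u∈X u~v with u ≟ x
        ... | yes u≡x = u≡x
        ... | no u≢x  = ⊥-elim (¬d (u , x∈p∧x≢y⇒x∈p-y u∈X u≢x , u~v))

        x~v : Adj G x v
        x~v with dom v v∉X
        ... | u , u∈X , u~v = subst (λ t → Adj G t v) (sole u u∈X u~v) u~v

  walk-to-neighbour : ∀ {u} → WalkIn G X u x → u ∈ X - x → ∃ λ y → WalkIn G (X - x) u y × Adj G y x
  walk-to-neighbour (WalkIn.here _) u∈X-x = ⊥-elim (x∉p-x u∈X-x)
  walk-to-neighbour {u} (WalkIn.step {w = w} _ u~w rest) u∈X-x with w ≟ x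
  ... | yes refl = u , WalkIn.here u∈X-x , u~w
  ... | no w≢x with walk-to-neighbour rest (x∈p∧x≢y⇒x∈p-y (walk-start∈ rest) w≢x)
  ...   | y , u→y , y~x = y , WalkIn.step u∈X-x u~w u→y , y~x

  removal-connected : x ∈ X → ConnectedIn G X → ∀ {c} →
    (∀ {y} → y ∈ X - x → Adj G y x → ¬ ¬ WalkIn G (X - x) y c) → ¬ ¬ ConnectedIn G (X - x)
  removal-connected x∈X conn {c} to-c k =
    ¬¬-shift (λ u → ¬¬-premise (reach u)) λ reach-all → k (hub⇒connected λ {u} → reach-all u)
    where
    reach : ∀ u → u ∈ X - x → ¬ ¬ WalkIn G (X - x) u c
    reach u u∈X-x with walk-to-neighbour (conn (p─q⊆p X ⁅ x ⁆ u∈X-x) x∈X) u∈X-x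
    ... | y , u→y , y~x = ¬¬-map (u→y ++ʷ_) (to-c (walk-end∈ u→y) y~x)

module _ {n : ℕ} {G : Graph n} {X : Subset n} where

  open InducedPath
  open PrivateNeighbour

  endpoint-private-neighbour : MinimalConnectedDominating G X → ∀ {m} {p : Fin (suc (suc m)) → Fin n} →
    InducedPath G p → (∀ i → p i ∈ X) → ¬ ¬ ∃ (PrivateNeighbour G p zero)
  endpoint-private-neighbour ((dom , conn) , minimal) {p = p} path p∈X no-pn =
    removal-dominating G dom (p₁ , p∈X-x (suc zero) (λ ()) , p₁~x)
      (λ v → no-pn ∘ (v ,_) ∘ external⇒private) λ dom′ →
    removal-connected G (p∈X zero) conn to-p₁ λ conn′ →
    minimal (X - x) (x∈p⇒p-x⊂p (p∈X zero)) (dom′ , conn′)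
    where
    x p₁ : Fin n
    x  = p zero
    p₁ = p (suc zero)

    p₁~x : Adj G p₁ x
    p₁~x = from (adjacent⇔ path (suc zero) zero) (inj₂ refl)

    p∈X-x : ∀ i → i ≢ zero → p i ∈ X - x
    p∈X-x i i≢0 = x∈p∧x≢y⇒x∈p-y (p∈X i) (i≢0 ∘ injective path)

    external⇒private : ∀ {v} → ExternalPrivateNeighbour G X x v → PrivateNeighbour G p zero v
    external⇒private (v∉X , x~v , sole-X) = record
      { adjacent = x~v
      ; sole     = λ j pj~v → injective path (sole-X (p j) (p∈X j) pj~v)
      ; off-path = λ j v≡pj → v∉X (subst (_∈ X) (≡-sym v≡pj) (p∈X j))
      }

    walk-to-p₁ : ∀ i → i ≢ zero → WalkIn G (X - x) (p i) p₁
    walk-to-p₁ zero    i≢0 = ⊥-elim (i≢0 refl)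
    walk-to-p₁ (suc j) _   =
      reverseʷ (walk-along (p ∘ suc) (λ t → p∈X-x (suc t) λ ()) (consecutive G path ∘ suc) j)

    to-p₁ : ∀ {y} → y ∈ X - x → Adj G y x → ¬ ¬ WalkIn G (X - x) y p₁
    to-p₁ {y} y∈X-x y~x k = ¬¬-excluded-middle {A = ∃ λ i → i ≢ zero × Near i} λ
      { (yes (i , i≢0 , near)) → k (step-to i i≢0 near ++ʷ walk-to-p₁ i i≢0)
      ; (no far)               → no-pn (y , private-neighbour far) }
      where
      Near : Fin _ → Set
      Near i = y ≡ p i ⊎ Adj G y (p i)

      step-to : ∀ i → i ≢ zero → Near i → WalkIn G (X - x) y (p i)
      step-to i _   (inj₁ y≡pi) = subst (WalkIn G (X - x) y) y≡pi (WalkIn.here y∈X-x)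
      step-to i i≢0 (inj₂ y~pi) = WalkIn.step y∈X-x y~pi (WalkIn.here (p∈X-x i i≢0))

      private-neighbour : ¬ (∃ λ i → i ≢ zero × Near i) → PrivateNeighbour G p zero y
      private-neighbour far = record { adjacent = sym G y~x ; sole = sole′ ; off-path = off-path′ }
        where
        sole′ : ∀ j → Adj G (p j) y → j ≡ zero
        sole′ j pj~y with j ≟ zero
        ... | yes j≡0 = j≡0
        ... | no j≢0  = ⊥-elim (far (j , j≢0 , inj₂ (sym G pj~y)))

        off-path′ : ∀ j → y ≢ p j
        off-path′ j y≡pj with j ≟ zero
        ... | yes refl = x∉p-x (subst (_∈ X - x) y≡pj y∈X-x)
        ... | no j≢0   = far (j , j≢0 , inj₁ y≡pj)

lemma1 : (k : ℕ) → 4 ≤ k → (n : ℕ) → (G : Graph n) → Connected G →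
    PathFree G k × CycleFree G k →
    (X : Subset n) → MinimalConnectedDominating G X →
    PathFreeIn G X (k ∸ 2)
lemma1 _ (s≤s (s≤s (s≤s (s≤s _)))) n G _ (P-free , C-free) X mcds (p , p-injective , p∈X , p-adjacent⇔) =
  endpoint-private-neighbour mcds path p∈X λ (y₁ , pn₁) →
  endpoint-private-neighbour mcds (reverse-path G path) (p∈X ∘ opposite) λ (y₂ , pn₂) →
  let open Extension path pn₁ (reverse-private G pn₂) in
  ¬¬-excluded-middle λ
    { (yes y₁~y₂) → C-free (cycle-extension y₁~y₂)
    ; (no y₁≁y₂)  → P-free (path-extension y₁≁y₂) }
  where
  path : InducedPath G p
  path = inducedPath p-injective p-adjacent⇔
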